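{- Let $n,k$ be integers with $0<k<n/2$ such that $k^2\equiv k\pmod n$ or $k^2\equiv -k\pmod n$. Then there exist a monoid $M$ which is an orthogroup and a subset $C\subseteq M$ such that $\mathrm{Cay}(M,C)$ has no loops and $G(n,k)$ is isomorphic to the underlying graph of $\mathrm{Cay}(M,C)$.
   Context: $G(n,k)$ ($0<k<n/2$) has vertices $u_0,\dots,u_{n-1},v_0,\dots,v_{n-1}$ and edges $u_iu_{i+1}$, $v_iv_{i+k}$, $u_iv_i$ (indices mod $n$). For a semigroup $S$ and $C\subseteq S$, $\mathrm{Cay}(S,C)$ is the directed multigraph with vertex set $S$ and one arc $(s,sc)$ for each $s\in S$, $c\in C$ (a loop when $sc=s$); its underlying graph is obtained by deleting loops, forgetting orientations and merging parallel edges. A semigroup is an orthogroup if it is a union of subgroups and its set of idempotents is a subsemigroup. -}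

module Defs where

open import Data.Nat using (ℕ; _+_; _*_)
open import Data.Fin using (Fin; toℕ)
open import Data.Sum using (_⊎_; inj₁; inj₂)
open import Data.Product using (Σ; ∃; _×_)
open import Relation.Binary.PropositionalEquality using (_≡_; _≢_)
open import Relation.Nullary using (¬_)

_≡_[mod_] : ℕ → ℕ → ℕ → Set
a ≡ b [mod n ] = (∃ λ q → a ≡ b + q * n) ⊎ (∃ λ q → b ≡ a + q * n)

-- Generalized Petersen graph G(n,k)
-- vertices: inj₁ i = u_i , inj₂ i = v_i  (i : Fin n)

GPVertex : ℕ → Set
GPVertex n = Fin n ⊎ Fin n

GPEdge : (n k : ℕ) → GPVertex n → GPVertex n → Set
GPEdge n k (inj₁ i) (inj₁ j) = (toℕ i + 1) ≡ toℕ j [mod n ]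
GPEdge n k (inj₂ i) (inj₂ j) = (toℕ i + k) ≡ toℕ j [mod n ]
GPEdge n k (inj₁ i) (inj₂ j) = i ≡ j
GPEdge n k (inj₂ i) (inj₁ j) = Data.Empty.⊥
  where import Data.Empty

GPAdj : (n k : ℕ) → GPVertex n → GPVertex n → Set
GPAdj n k x y = GPEdge n k x y ⊎ GPEdge n k y x

module _ {A : Set} (_∙_ : A → A → A) (C : A → Set) where

  CayArc : A → A → Set
  CayArc s t = ∃ λ c → C c × (s ∙ c ≡ t)

  CayLoopless : Set
  CayLoopless = ∀ s c → C c → s ∙ c ≢ s

  -- adjacency in the underlying graph: delete loops, forget orientation,
  -- merge parallel edges
  UnderlyingAdj : A → A → Set
  UnderlyingAdj x y = x ≢ y × (CayArc x y ⊎ CayArc y x)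

module _ {A : Set} (_∙_ : A → A → A) where

  IsSubgroup : (A → Set) → Set
  IsSubgroup H =
    (∀ x y → H x → H y → H (x ∙ y)) ×
    (Σ A λ e → H e ×
       ((∀ h → H h → (e ∙ h ≡ h) × (h ∙ e ≡ h)) ×
        (∀ h → H h → Σ A λ h' → H h' × (h ∙ h' ≡ e) × (h' ∙ h ≡ e))))

  UnionOfSubgroups : Set₁
  UnionOfSubgroups = ∀ a → Σ (A → Set) λ H → IsSubgroup H × H a

  IsIdempotent : A → Set
  IsIdempotent e = e ∙ e ≡ e

  IdempotentsClosed : Set
  IdempotentsClosed = ∀ e f → IsIdempotent e → IsIdempotent f → IsIdempotent (e ∙ f)

  IsOrthogroup : Set₁
  IsOrthogroup = UnionOfSubgroups × IdempotentsClosed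

-- For an idempotent endomorphism μ of an abelian group G, write μ⁰ = id and μ¹ = μ. The set
-- G × Bool with (a , s) ∙ (b , t) = (a + μˢ b , s ∨ t) is a monoid and an orthogroup: for
-- each s the elements (b , s) with a common value c = b − μˢ b form a group with identity
-- (c , s), and the idempotents are the (e , s) with μˢ e = 0, a set closed under ∙.
-- Take G = ℤ/n and μ x = m x with m = k if k² ≡ k and m = −k if k² ≡ −k, so that m² = m.
-- Right multiplication by the generators (1 , false) and (1 , true) sends (a , false) to
-- (a + 1 , false) and (a + 1 , true), and (a , true) to (a + m , true); it has no fixed points
-- because 1 and m are nonzero. So u_i ↦ (i , false), v_i ↦ (i + 1 , true) carries the rim,
-- the spokes and the inner edges v_i v_(i±k) = v_i v_(i±m) of G(n,k) onto the underlying graph.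

module Submission where

open import Defs
open import Data.Nat using (ℕ; _+_; _*_; _<_)
open import Data.Product using (Σ; _×_)
open import Data.Sum using (_⊎_)
open import Relation.Binary.PropositionalEquality using (_≡_)
open import Algebra.Structures using (IsMonoid)
open import Function.Bundles using (_↔_; _⇔_; Inverse)

open import Level using (0ℓ)
open import Algebra.Bundles using (AbelianGroup; Ring)
open import Algebra.Core using (Op₁; Op₂)
open import Algebra.Structures using (IsAbelianGroup; IsRing)
import Algebra.Properties.AbelianGroup as AbelianGroupProperties
import Algebra.Properties.CommutativeSemigroup as CommutativeSemigroupProperties
import Algebra.Properties.Ring as RingProperties
open import Data.Bool using (Bool; true; false; _∨_)
open import Data.Bool.Properties using (∨-assoc; ∨-comm; ∨-idem; ∨-identityʳ)
open import Data.Empty using (⊥)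
open import Data.Fin using (Fin; toℕ)
open import Data.Fin.Properties using (toℕ-fromℕ<; toℕ-injective; toℕ<n; toℕ≤n)
open import Data.Nat using (zero; suc; z<s; NonZero; >-nonZero⁻¹; _≤_; _∸_; _/_; _%_)
open import Data.Nat.DivMod
  using (_mod_; m%n<n; m<n⇒m%n≡m; n%n≡0; %-distribˡ-+; %-distribˡ-*; [m+kn]%n≡m%n; m≡m%n+[m/n]*n)
import Data.Nat.Properties as ℕ
open import Data.Product using (_,_; proj₁; proj₂)
open import Data.Product.Properties using (,-injectiveˡ)
open import Data.Sum using (inj₁; inj₂; map; swap)
open import Data.Sum.Function.Propositional using (_⊎-⇔_)
open import Function.Base using (_∘_)
open import Function.Bundles using (mk⇔; mk↔ₛ′)
open import Function.Construct.Composition using (_⇔-∘_)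
open import Function.Construct.Identity using (⇔-id)
open import Function.Construct.Symmetry using (⇔-sym)
open import Function.Related.Propositional using (module EquationalReasoning)
open import Relation.Binary.PropositionalEquality
  using (refl; sym; trans; cong; cong₂; isEquivalence; _≢_; module ≡-Reasoning)

module IdempotentExtension
  {G : Set} {_+_ : Op₂ G} {0# : G} { -_ : Op₁ G}
  (isAbelianGroup : IsAbelianGroup _≡_ _+_ 0# -_)
  (μ : G → G)
  (μ-+ : ∀ x y → μ (x + y) ≡ μ x + μ y)
  (μ-idem : ∀ x → μ (μ x) ≡ μ x)
  where

  open IsAbelianGroup isAbelianGroup
    using (assoc; identityˡ; identityʳ; inverseˡ; inverseʳ; _-_)
  private
    abelianGroup : AbelianGroup 0ℓ 0ℓ
    abelianGroup = record { isAbelianGroup = isAbelianGroup }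

  open AbelianGroupProperties abelianGroup
    using (identityʳ-unique; inverseʳ-unique; ε⁻¹≈ε; ⁻¹-∙-comm; //-rightDividesˡ; //-rightDividesʳ)
  open CommutativeSemigroupProperties (AbelianGroup.commutativeSemigroup abelianGroup)
    using (interchange)
  open ≡-Reasoning

  act : Bool → G → G
  act false x = x
  act true  x = μ x

  act-+ : ∀ s x y → act s (x + y) ≡ act s x + act s y
  act-+ false x y = refl
  act-+ true  x y = μ-+ x y

  act-∘ : ∀ s t x → act s (act t x) ≡ act (s ∨ t) x
  act-∘ false t     x = refl
  act-∘ true  false x = refl
  act-∘ true  true  x = μ-idem x

  act-idem : ∀ s x → act s (act s x) ≡ act s x
  act-idem s x = trans (act-∘ s s x) (cong (λ u → act u x) (∨-idem s))

  act-0 : ∀ s → act s 0# ≡ 0#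
  act-0 s = identityʳ-unique (act s 0#) (act s 0#)
    (trans (sym (act-+ s 0# 0#)) (cong (act s) (identityˡ 0#)))

  act-⁻¹ : ∀ s x → act s (- x) ≡ - act s x
  act-⁻¹ s x = inverseʳ-unique (act s x) (act s (- x))
    (trans (sym (act-+ s x (- x))) (trans (cong (act s) (inverseʳ x)) (act-0 s)))

  M : Set
  M = G × Bool

  infixl 7 _∙_
  _∙_ : Op₂ M
  (a , s) ∙ (b , t) = a + act s b , s ∨ t

  ε : M
  ε = 0# , false

  ∙-assoc : ∀ x y z → (x ∙ y) ∙ z ≡ x ∙ (y ∙ z)
  ∙-assoc (a , s) (b , t) (c , u) = cong₂ _,_ first (∨-assoc s t u)
    where
    first : (a + act s b) + act (s ∨ t) c ≡ a + act s (b + act t c)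
    first = begin
      (a + act s b) + act (s ∨ t) c        ≡⟨ assoc a (act s b) _ ⟩
      a + (act s b + act (s ∨ t) c)        ≡⟨ cong (λ z → a + (act s b + z)) (act-∘ s t c) ⟨
      a + (act s b + act s (act t c))      ≡⟨ cong (a +_) (act-+ s b (act t c)) ⟨
      a + act s (b + act t c)              ∎

  isMonoid : IsMonoid _≡_ _∙_ ε
  isMonoid = record
    { isSemigroup = record
      { isMagma = record { isEquivalence = isEquivalence ; ∙-cong = cong₂ _∙_ }
      ; assoc   = ∙-assoc
      }
    ; identity = (λ { (b , t) → cong (_, t) (identityˡ b) })
               , (λ { (a , s) → cong₂ _,_ (trans (cong (a +_) (act-0 s)) (identityʳ a)) (∨-identityʳ s) })
    }

  -- ρ s projects G onto the kernel of act s; its fibres label the maximal subgroups in layer s.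
  ρ : Bool → G → G
  ρ s x = x - act s x

  act-ρ : ∀ s x → act s (ρ s x) ≡ 0#
  act-ρ s x = begin
    act s (x - act s x)               ≡⟨ act-+ s x _ ⟩
    act s x + act s (- act s x)       ≡⟨ cong (act s x +_) (act-⁻¹ s (act s x)) ⟩
    act s x - act s (act s x)         ≡⟨ cong (λ z → act s x - z) (act-idem s x) ⟩
    act s x - act s x                 ≡⟨ inverseʳ (act s x) ⟩
    0#                                ∎

  ρ-idem : ∀ s x → ρ s (ρ s x) ≡ ρ s x
  ρ-idem s x = begin
    ρ s x - act s (ρ s x)   ≡⟨ cong (λ z → ρ s x - z) (act-ρ s x) ⟩
    ρ s x - 0#              ≡⟨ cong (ρ s x +_) ε⁻¹≈ε ⟩
    ρ s x + 0#              ≡⟨ identityʳ (ρ s x) ⟩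
    ρ s x                   ∎

  ρ-+act : ∀ s x y → ρ s (x + act s y) ≡ ρ s x
  ρ-+act s x y = begin
    (x + act s y) - act s (x + act s y)           ≡⟨ cong (λ z → (x + act s y) - z) (act-+ s x (act s y)) ⟩
    (x + act s y) - (act s x + act s (act s y))   ≡⟨ cong (λ z → (x + act s y) - (act s x + z)) (act-idem s y) ⟩
    (x + act s y) - (act s x + act s y)           ≡⟨ cong ((x + act s y) +_) (⁻¹-∙-comm (act s x) (act s y)) ⟨
    (x + act s y) + ((- act s x) + (- act s y))   ≡⟨ interchange x (act s y) _ _ ⟩
    (x - act s x) + (act s y - act s y)           ≡⟨ cong (ρ s x +_) (inverseʳ (act s y)) ⟩
    ρ s x + 0#                                    ≡⟨ identityʳ (ρ s x) ⟩
    ρ s x                                         ∎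

  ρ+act : ∀ s x → ρ s x + act s x ≡ x
  ρ+act s x = begin
    (x - act s x) + act s x       ≡⟨ assoc x _ _ ⟩
    x + ((- act s x) + act s x)   ≡⟨ cong (x +_) (inverseˡ (act s x)) ⟩
    x + 0#                        ≡⟨ identityʳ x ⟩
    x                             ∎

  HClass : M → M → Set
  HClass (a , s) (b , t) = t ≡ s × ρ s b ≡ ρ s a

  HClass-isSubgroup : ∀ x → IsSubgroup _∙_ (HClass x)
  HClass-isSubgroup (a , s) = closed , (e , s) , (refl , ρ-idem s a) , identity , inverse
    where
    e : G
    e = ρ s a

    closed : ∀ y z → HClass (a , s) y → HClass (a , s) z → HClass (a , s) (y ∙ z)
    closed (b , _) (c , _) (refl , hb) (refl , _) = ∨-idem s , trans (ρ-+act s b c) hb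

    identity : ∀ y → HClass (a , s) y → ((e , s) ∙ y ≡ y) × (y ∙ (e , s) ≡ y)
    identity (b , _) (refl , hb) =
      cong₂ _,_ (trans (cong (_+ act s b) (sym hb)) (ρ+act s b)) (∨-idem s) ,
      cong₂ _,_ (trans (cong (b +_) (act-ρ s a)) (identityʳ b)) (∨-idem s)

    inverse : ∀ y → HClass (a , s) y →
              Σ M λ y' → HClass (a , s) y' × (y ∙ y' ≡ (e , s)) × (y' ∙ y ≡ (e , s))
    inverse (b , _) (refl , hb) =
      (b' , s) , (refl , trans (ρ-+act s e (- b)) (ρ-idem s a)) ,
      cong₂ _,_ right (∨-idem s) , cong₂ _,_ left (∨-idem s)
      where
      b' : G
      b' = e + act s (- b)

      right : b + act s b' ≡ e
      right = begin
        b + act s (e + act s (- b))          ≡⟨ cong (b +_) (act-+ s e _) ⟩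
        b + (act s e + act s (act s (- b)))  ≡⟨ cong₂ (λ u v → b + (u + v)) (act-ρ s a) (act-idem s (- b)) ⟩
        b + (0# + act s (- b))               ≡⟨ cong (b +_) (identityˡ _) ⟩
        b + act s (- b)                      ≡⟨ cong (b +_) (act-⁻¹ s b) ⟩
        ρ s b                                ≡⟨ hb ⟩
        e                                    ∎

      left : b' + act s b ≡ e
      left = begin
        (e + act s (- b)) + act s b  ≡⟨ assoc e _ _ ⟩
        e + (act s (- b) + act s b)  ≡⟨ cong (e +_) (act-+ s (- b) b) ⟨
        e + act s ((- b) + b)        ≡⟨ cong (λ z → e + act s z) (inverseˡ b) ⟩
        e + act s 0#                 ≡⟨ cong (e +_) (act-0 s) ⟩
        e + 0#                       ≡⟨ identityʳ e ⟩
        e                            ∎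

  idempotent⇒act≡0 : ∀ {e s} → IsIdempotent _∙_ (e , s) → act s e ≡ 0#
  idempotent⇒act≡0 {e} {s} idem = identityʳ-unique e (act s e) (,-injectiveˡ idem)

  act≡0⇒idempotent : ∀ {e s} → act s e ≡ 0# → IsIdempotent _∙_ (e , s)
  act≡0⇒idempotent {e} {s} h = cong₂ _,_ (trans (cong (e +_) h) (identityʳ e)) (∨-idem s)

  act-comm : ∀ s t x → act s (act t x) ≡ act t (act s x)
  act-comm s t x = trans (act-∘ s t x) (trans (cong (λ u → act u x) (∨-comm s t)) (sym (act-∘ t s x)))

  act-∨-annihilatesˡ : ∀ s t {x} → act s x ≡ 0# → act (s ∨ t) x ≡ 0#
  act-∨-annihilatesˡ s t {x} h = begin
    act (s ∨ t) x      ≡⟨ act-∘ s t x ⟨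
    act s (act t x)    ≡⟨ act-comm s t x ⟩
    act t (act s x)    ≡⟨ cong (act t) h ⟩
    act t 0#           ≡⟨ act-0 t ⟩
    0#                 ∎

  act-∨-annihilatesʳ : ∀ s t {x} → act t x ≡ 0# → act (s ∨ t) x ≡ 0#
  act-∨-annihilatesʳ s t {x} h =
    trans (cong (λ u → act u x) (∨-comm s t)) (act-∨-annihilatesˡ t s h)

  isOrthogroup : IsOrthogroup _∙_
  isOrthogroup = (λ x → HClass x , HClass-isSubgroup x , refl , refl) , closed
    where
    closed : IdempotentsClosed _∙_
    closed (e , s) (f , t) he hf = act≡0⇒idempotent (begin
      act (s ∨ t) (e + act s f)              ≡⟨ act-+ (s ∨ t) e (act s f) ⟩
      act (s ∨ t) e + act (s ∨ t) (act s f)  ≡⟨ cong₂ _+_ (act-∨-annihilatesˡ s t actˢe≡0)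
                                                           (act-∨-annihilatesʳ s t actᵗactˢf≡0) ⟩
      0# + 0#                                ≡⟨ identityˡ 0# ⟩
      0#                                     ∎)
      where
      actˢe≡0 : act s e ≡ 0#
      actˢe≡0 = idempotent⇒act≡0 he

      actᵗactˢf≡0 : act t (act s f) ≡ 0#
      actᵗactˢf≡0 = trans (act-comm t s f) (trans (cong (act s) (idempotent⇒act≡0 hf)) (act-0 s))

  module Cayley (g : G) where

    generators : M → Set
    generators (c , _) = c ≡ g

    Step : M → M → Set
    Step (a , false) (b , _)     = a + g ≡ b
    Step (a , true)  (b , false) = ⊥
    Step (a , true)  (b , true)  = a + μ g ≡ b

    arc⇒step : ∀ {x y} → CayArc _∙_ generators x y → Step x y
    arc⇒step {_ , false} (_ , refl , refl) = refl
    arc⇒step {_ , true}  (_ , refl , refl) = refl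

    step⇒arc : ∀ {x y} → Step x y → CayArc _∙_ generators x y
    step⇒arc {_ , false} {_ , t}    refl = (g , t) , refl , refl
    step⇒arc {_ , true}  {_ , true} refl = (g , true) , refl , refl

    module _ (act-g≢0 : ∀ s → act s g ≢ 0#) where

      loopless : CayLoopless _∙_ generators
      loopless (a , s) _ refl loop = act-g≢0 s (identityʳ-unique a (act s g) (,-injectiveˡ loop))

      step-irreflexive : ∀ {x y} → Step x y → x ≢ y
      step-irreflexive st refl with step⇒arc st
      ... | c , gen , loop = loopless _ c gen loop

      underlyingAdj⇔step : ∀ x y → UnderlyingAdj _∙_ generators x y ⇔ (Step x y ⊎ Step y x)
      underlyingAdj⇔step x y = mk⇔
        (λ (_ , arc) → map arc⇒step arc⇒step arc)
        λ { (inj₁ st) → step-irreflexive st , inj₁ (step⇒arc st)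
          ; (inj₂ st) → (λ x≡y → step-irreflexive st (sym x≡y)) , inj₂ (step⇒arc st) }

    -- The second layer is shifted by g so that (a , false) ∙ (g , true) is the image of inj₂ a.
    layers : (G ⊎ G) ↔ M
    layers = mk↔ₛ′ to from to∘from from∘to
      where
      to : G ⊎ G → M
      to (inj₁ a) = a , false
      to (inj₂ a) = a + g , true

      from : M → G ⊎ G
      from (a , false) = inj₁ a
      from (a , true)  = inj₂ (a - g)

      to∘from : ∀ x → to (from x) ≡ x
      to∘from (a , false) = refl
      to∘from (a , true)  = cong (_, true) (//-rightDividesˡ g a)

      from∘to : ∀ x → from (to x) ≡ x
      from∘to (inj₁ a) = refl
      from∘to (inj₂ a) = cong inj₂ (//-rightDividesʳ g a)

module ResidueRing (n : ℕ) .{{_ : NonZero n}} where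

  private variable x x′ y y′ : ℕ

  open ≡-Reasoning

  [_] : ℕ → Fin n
  [ a ] = a mod n

  toℕ-[] : ∀ a → toℕ [ a ] ≡ a % n
  toℕ-[] a = toℕ-fromℕ< (m%n<n a n)

  []-toℕ : ∀ i → [ toℕ i ] ≡ i
  []-toℕ i = toℕ-injective (trans (toℕ-[] (toℕ i)) (m<n⇒m%n≡m (toℕ<n i)))

  []≡[]⇒%≡% : [ x ] ≡ [ y ] → x % n ≡ y % n
  []≡[]⇒%≡% {a} {b} eq = trans (sym (toℕ-[] a)) (trans (cong toℕ eq) (toℕ-[] b))

  %≡%⇒[]≡[] : x % n ≡ y % n → [ x ] ≡ [ y ]
  %≡%⇒[]≡[] {a} {b} eq = toℕ-injective (trans (toℕ-[] a) (trans eq (sym (toℕ-[] b))))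

  []-injective : x < n → y < n → [ x ] ≡ [ y ] → x ≡ y
  []-injective a<n b<n eq = trans (sym (m<n⇒m%n≡m a<n)) (trans ([]≡[]⇒%≡% eq) (m<n⇒m%n≡m b<n))

  [+]-cong : [ x ] ≡ [ x′ ] → [ y ] ≡ [ y′ ] → [ x + y ] ≡ [ x′ + y′ ]
  [+]-cong {a} {a′} {b} {b′} p q = %≡%⇒[]≡[] (begin
    (a + b) % n              ≡⟨ %-distribˡ-+ a b n ⟩
    (a % n + b % n) % n      ≡⟨ cong₂ (λ x y → (x + y) % n) ([]≡[]⇒%≡% p) ([]≡[]⇒%≡% q) ⟩
    (a′ % n + b′ % n) % n    ≡⟨ %-distribˡ-+ a′ b′ n ⟨
    (a′ + b′) % n            ∎)

  [*]-cong : [ x ] ≡ [ x′ ] → [ y ] ≡ [ y′ ] → [ x * y ] ≡ [ x′ * y′ ]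
  [*]-cong {a} {a′} {b} {b′} p q = %≡%⇒[]≡[] (begin
    (a * b) % n              ≡⟨ %-distribˡ-* a b n ⟩
    (a % n * (b % n)) % n    ≡⟨ cong₂ (λ x y → (x * y) % n) ([]≡[]⇒%≡% p) ([]≡[]⇒%≡% q) ⟩
    (a′ % n * (b′ % n)) % n  ≡⟨ %-distribˡ-* a′ b′ n ⟨
    (a′ * b′) % n            ∎)

  ≡[mod]⇒[]≡[] : x ≡ y [mod n ] → [ x ] ≡ [ y ]
  ≡[mod]⇒[]≡[] (inj₁ (q , refl)) = %≡%⇒[]≡[] ([m+kn]%n≡m%n _ q n)
  ≡[mod]⇒[]≡[] (inj₂ (q , refl)) = sym (%≡%⇒[]≡[] ([m+kn]%n≡m%n _ q n))

  %≡%⇒≡+*n : x % n ≡ y % n → y / n ≤ x / n → x ≡ y + (x / n ∸ y / n) * n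
  %≡%⇒≡+*n {a} {b} eq b/n≤a/n = begin
    a                                     ≡⟨ m≡m%n+[m/n]*n a n ⟩
    a % n + a / n * n                     ≡⟨ cong₂ (λ x y → x + y * n) eq (sym (ℕ.m+[n∸m]≡n b/n≤a/n)) ⟩
    b % n + (b / n + (a / n ∸ b / n)) * n ≡⟨ cong (b % n +_) (ℕ.*-distribʳ-+ n (b / n) _) ⟩
    b % n + (b / n * n + d * n)           ≡⟨ ℕ.+-assoc (b % n) _ _ ⟨
    b % n + b / n * n + d * n             ≡⟨ cong (_+ d * n) (m≡m%n+[m/n]*n b n) ⟨
    b + d * n                             ∎
    where d = a / n ∸ b / n

  []≡[]⇒≡[mod] : [ x ] ≡ [ y ] → x ≡ y [mod n ]
  []≡[]⇒≡[mod] {a} {b} eq with ℕ.≤-total (b / n) (a / n)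
  ... | inj₁ b/n≤a/n = inj₁ (a / n ∸ b / n , %≡%⇒≡+*n ([]≡[]⇒%≡% eq) b/n≤a/n)
  ... | inj₂ a/n≤b/n = inj₂ (b / n ∸ a / n , %≡%⇒≡+*n (sym ([]≡[]⇒%≡% eq)) a/n≤b/n)

  infixl 6 _+ₙ_
  infixl 7 _*ₙ_
  infix  8 -ₙ_

  _+ₙ_ _*ₙ_ : Fin n → Fin n → Fin n
  i +ₙ j = [ toℕ i + toℕ j ]
  i *ₙ j = [ toℕ i * toℕ j ]

  -ₙ_ : Fin n → Fin n
  -ₙ i = [ n ∸ toℕ i ]

  0ₙ 1ₙ : Fin n
  0ₙ = [ 0 ]
  1ₙ = [ 1 ]

  [+]-hom : ∀ x y → [ x + y ] ≡ [ x ] +ₙ [ y ]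
  [+]-hom a b = [+]-cong (sym ([]-toℕ [ a ])) (sym ([]-toℕ [ b ]))

  [*]-hom : ∀ x y → [ x * y ] ≡ [ x ] *ₙ [ y ]
  [*]-hom a b = [*]-cong (sym ([]-toℕ [ a ])) (sym ([]-toℕ [ b ]))

  isRing : IsRing _≡_ _+ₙ_ _*ₙ_ -ₙ_ 0ₙ 1ₙ
  isRing = record
    { +-isAbelianGroup = record
      { isGroup = record
        { isMonoid = record
          { isSemigroup = record
            { isMagma = record { isEquivalence = isEquivalence ; ∙-cong = cong₂ _+ₙ_ }
            ; assoc   = +-assoc
            }
          ; identity = +-identityˡ , +-identityʳ
          }
        ; inverse = -‿inverseˡ , -‿inverseʳ
        ; ⁻¹-cong = cong -ₙ_
        }
      ; comm = +-comm
      }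
    ; *-cong     = cong₂ _*ₙ_
    ; *-assoc    = *-assoc
    ; *-identity = *-identityˡ , *-identityʳ
    ; distrib    = distribˡ , distribʳ
    }
    where
    +-assoc : ∀ i j k → (i +ₙ j) +ₙ k ≡ i +ₙ (j +ₙ k)
    +-assoc i j k = begin
      [ toℕ [ a + b ] + c ]  ≡⟨ [+]-cong ([]-toℕ [ a + b ]) refl ⟩
      [ a + b + c ]          ≡⟨ cong [_] (ℕ.+-assoc a b c) ⟩
      [ a + (b + c) ]        ≡⟨ [+]-cong refl ([]-toℕ [ b + c ]) ⟨
      [ a + toℕ [ b + c ] ]  ∎
      where a = toℕ i ; b = toℕ j ; c = toℕ k

    +-comm : ∀ i j → i +ₙ j ≡ j +ₙ i
    +-comm i j = cong [_] (ℕ.+-comm (toℕ i) (toℕ j))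

    +-identityˡ : ∀ i → 0ₙ +ₙ i ≡ i
    +-identityˡ i = trans ([+]-cong ([]-toℕ 0ₙ) refl) ([]-toℕ i)

    +-identityʳ : ∀ i → i +ₙ 0ₙ ≡ i
    +-identityʳ i = trans (+-comm i 0ₙ) (+-identityˡ i)

    -‿inverseˡ : ∀ i → -ₙ i +ₙ i ≡ 0ₙ
    -‿inverseˡ i = begin
      [ toℕ [ n ∸ a ] + a ]  ≡⟨ [+]-cong ([]-toℕ [ n ∸ a ]) refl ⟩
      [ n ∸ a + a ]          ≡⟨ cong [_] (ℕ.m∸n+n≡m (toℕ≤n i)) ⟩
      [ n ]                  ≡⟨ %≡%⇒[]≡[] (trans (n%n≡0 n) (sym (m<n⇒m%n≡m (>-nonZero⁻¹ n)))) ⟩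
      [ 0 ]                  ∎
      where a = toℕ i

    -‿inverseʳ : ∀ i → i +ₙ -ₙ i ≡ 0ₙ
    -‿inverseʳ i = trans (+-comm i (-ₙ i)) (-‿inverseˡ i)

    *-assoc : ∀ i j k → (i *ₙ j) *ₙ k ≡ i *ₙ (j *ₙ k)
    *-assoc i j k = begin
      [ toℕ [ a * b ] * c ]  ≡⟨ [*]-cong ([]-toℕ [ a * b ]) refl ⟩
      [ a * b * c ]          ≡⟨ cong [_] (ℕ.*-assoc a b c) ⟩
      [ a * (b * c) ]        ≡⟨ [*]-cong {x = a} refl ([]-toℕ [ b * c ]) ⟨
      [ a * toℕ [ b * c ] ]  ∎
      where a = toℕ i ; b = toℕ j ; c = toℕ k

    *-identityˡ : ∀ i → 1ₙ *ₙ i ≡ i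
    *-identityˡ i = begin
      [ toℕ 1ₙ * a ]  ≡⟨ [*]-cong ([]-toℕ 1ₙ) refl ⟩
      [ 1 * a ]       ≡⟨ cong [_] (ℕ.*-identityˡ a) ⟩
      [ a ]           ≡⟨ []-toℕ i ⟩
      i               ∎
      where a = toℕ i

    *-identityʳ : ∀ i → i *ₙ 1ₙ ≡ i
    *-identityʳ i = begin
      [ a * toℕ 1ₙ ]  ≡⟨ [*]-cong {x = a} refl ([]-toℕ 1ₙ) ⟩
      [ a * 1 ]       ≡⟨ cong [_] (ℕ.*-identityʳ a) ⟩
      [ a ]           ≡⟨ []-toℕ i ⟩
      i               ∎
      where a = toℕ i

    distribˡ : ∀ i j k → i *ₙ (j +ₙ k) ≡ i *ₙ j +ₙ i *ₙ k
    distribˡ i j k = begin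
      [ a * toℕ [ b + c ] ]             ≡⟨ [*]-cong {x = a} refl ([]-toℕ [ b + c ]) ⟩
      [ a * (b + c) ]                   ≡⟨ cong [_] (ℕ.*-distribˡ-+ a b c) ⟩
      [ a * b + a * c ]                 ≡⟨ [+]-cong ([]-toℕ [ a * b ]) ([]-toℕ [ a * c ]) ⟨
      [ toℕ [ a * b ] + toℕ [ a * c ] ] ∎
      where a = toℕ i ; b = toℕ j ; c = toℕ k

    distribʳ : ∀ i j k → (j +ₙ k) *ₙ i ≡ j *ₙ i +ₙ k *ₙ i
    distribʳ i j k = begin
      [ toℕ [ b + c ] * a ]             ≡⟨ [*]-cong ([]-toℕ [ b + c ]) refl ⟩
      [ (b + c) * a ]                   ≡⟨ cong [_] (ℕ.*-distribʳ-+ a b c) ⟩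
      [ b * a + c * a ]                 ≡⟨ [+]-cong ([]-toℕ [ b * a ]) ([]-toℕ [ c * a ]) ⟨
      [ toℕ [ b * a ] + toℕ [ c * a ] ] ∎
      where a = toℕ i ; b = toℕ j ; c = toℕ k

  ring : Ring 0ℓ 0ℓ
  ring = record { isRing = isRing }

module GeneralizedPetersen (n : ℕ) .{{_ : NonZero n}} where

  open ResidueRing n
  open Ring ring using (+-isAbelianGroup; +-comm; +-assoc; *-assoc; *-identityʳ; distribˡ)
  open RingProperties ring
    using (-‿distribˡ-*; -‿distribʳ-*; -‿involutive; +-inverseˡ-unique; -0#≈0#; +-cancelʳ;
           //-rightDividesˡ; //-rightDividesʳ)

  []≢0ₙ : ∀ {x} → 0 < x → x < n → [ x ] ≢ 0ₙ
  []≢0ₙ 0<x x<n eq = ℕ.<⇒≢ 0<x (sym ([]-injective x<n (>-nonZero⁻¹ n) eq))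

  idempotentMultiplier : ∀ k → ((k * k) ≡ k [mod n ]) ⊎ ((k * k + k) ≡ 0 [mod n ]) →
    Σ (Fin n) λ m → m *ₙ m ≡ m × ([ k ] ≡ m ⊎ [ k ] ≡ -ₙ m)
  idempotentMultiplier k (inj₁ k²≡k) =
    [ k ] , trans (sym ([*]-hom k k)) (≡[mod]⇒[]≡[] k²≡k) , inj₁ refl
  idempotentMultiplier k (inj₂ k²+k≡0) =
    -ₙ [ k ] , idempotent , inj₂ (sym (-‿involutive [ k ]))
    where
    open ≡-Reasoning
    [k²]≡-[k] : [ k * k ] ≡ -ₙ [ k ]
    [k²]≡-[k] = +-inverseˡ-unique [ k * k ] [ k ]
      (trans (sym ([+]-hom (k * k) k)) (≡[mod]⇒[]≡[] k²+k≡0))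

    idempotent : -ₙ [ k ] *ₙ -ₙ [ k ] ≡ -ₙ [ k ]
    idempotent = begin
      -ₙ [ k ] *ₙ -ₙ [ k ]     ≡⟨ -‿distribˡ-* [ k ] (-ₙ [ k ]) ⟨
      -ₙ ([ k ] *ₙ -ₙ [ k ])   ≡⟨ cong -ₙ_ (-‿distribʳ-* [ k ] [ k ]) ⟨
      -ₙ -ₙ ([ k ] *ₙ [ k ])   ≡⟨ -‿involutive _ ⟩
      [ k ] *ₙ [ k ]           ≡⟨ [*]-hom k k ⟨
      [ k * k ]                ≡⟨ [k²]≡-[k] ⟩
      -ₙ [ k ]                 ∎

  toℕ+≡[mod]⇔ : ∀ i j c → ((toℕ i + c) ≡ toℕ j [mod n ]) ⇔ (i +ₙ [ c ] ≡ j)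
  toℕ+≡[mod]⇔ i j c = mk⇔
    (λ h → trans (sym lhs) (trans (≡[mod]⇒[]≡[] h) ([]-toℕ j)))
    (λ h → []≡[]⇒≡[mod] (trans lhs (trans h (sym ([]-toℕ j)))))
    where
    lhs : [ toℕ i + c ] ≡ i +ₙ [ c ]
    lhs = [+]-cong refl (sym ([]-toℕ [ c ]))

  translation-by-±⇔ : ∀ {h m} → h ≡ m ⊎ h ≡ -ₙ m → ∀ i j →
    ((i +ₙ h ≡ j) ⊎ (j +ₙ h ≡ i)) ⇔ ((i +ₙ m ≡ j) ⊎ (j +ₙ m ≡ i))
  translation-by-±⇔ (inj₁ refl) i j = ⇔-id _
  translation-by-±⇔ {m = m} (inj₂ refl) i j =
    mk⇔ (swap ∘ map (subtract⇒add i j) (subtract⇒add j i))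
        (map (add⇒subtract i j) (add⇒subtract j i) ∘ swap)
    where
    subtract⇒add : ∀ x y → x +ₙ -ₙ m ≡ y → y +ₙ m ≡ x
    subtract⇒add x y refl = //-rightDividesˡ m x
    add⇒subtract : ∀ x y → y +ₙ m ≡ x → x +ₙ -ₙ m ≡ y
    add⇒subtract x y refl = //-rightDividesʳ m y

  module CayleyPresentation (k : ℕ)
    (hyp : ((k * k) ≡ k [mod n ]) ⊎ ((k * k + k) ≡ 0 [mod n ]))
    (1ₙ≢0ₙ : 1ₙ ≢ 0ₙ) ([k]≢0ₙ : [ k ] ≢ 0ₙ)
    where

    m : Fin n
    m = proj₁ (idempotentMultiplier k hyp)

    m-idem : m *ₙ m ≡ m
    m-idem = proj₁ (proj₂ (idempotentMultiplier k hyp))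

    [k]≡±m : [ k ] ≡ m ⊎ [ k ] ≡ -ₙ m
    [k]≡±m = proj₂ (proj₂ (idempotentMultiplier k hyp))

    open IdempotentExtension +-isAbelianGroup (m *ₙ_) (distribˡ m)
      (λ x → trans (sym (*-assoc m m x)) (cong (_*ₙ x) m-idem)) public
    open Cayley 1ₙ public

    m≢0ₙ : m ≢ 0ₙ
    m≢0ₙ m≡0 with [k]≡±m
    ... | inj₁ [k]≡m  = [k]≢0ₙ (trans [k]≡m m≡0)
    ... | inj₂ [k]≡-m = [k]≢0ₙ (trans [k]≡-m (trans (cong -ₙ_ m≡0) -0#≈0#))

    act-1ₙ≢0ₙ : ∀ s → act s 1ₙ ≢ 0ₙ
    act-1ₙ≢0ₙ false = 1ₙ≢0ₙ
    act-1ₙ≢0ₙ true  = m≢0ₙ ∘ trans (sym (*-identityʳ m))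

    layer₂-step⇔ : ∀ i j → (i +ₙ m ≡ j) ⇔ ((i +ₙ 1ₙ) +ₙ m *ₙ 1ₙ ≡ j +ₙ 1ₙ)
    layer₂-step⇔ i j = mk⇔
      (λ h → trans reorder (cong (_+ₙ 1ₙ) h))
      (λ h → +-cancelʳ 1ₙ _ _ (trans (sym reorder) h))
      where
      open ≡-Reasoning
      reorder : (i +ₙ 1ₙ) +ₙ m *ₙ 1ₙ ≡ (i +ₙ m) +ₙ 1ₙ
      reorder = begin
        (i +ₙ 1ₙ) +ₙ m *ₙ 1ₙ  ≡⟨ cong ((i +ₙ 1ₙ) +ₙ_) (*-identityʳ m) ⟩
        (i +ₙ 1ₙ) +ₙ m        ≡⟨ +-assoc i 1ₙ m ⟩
        i +ₙ (1ₙ +ₙ m)        ≡⟨ cong (i +ₙ_) (+-comm 1ₙ m) ⟩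
        i +ₙ (m +ₙ 1ₙ)        ≡⟨ +-assoc i m 1ₙ ⟨
        (i +ₙ m) +ₙ 1ₙ        ∎

    vertex : GPVertex n → M
    vertex = Inverse.to layers

    gpAdj⇔step : ∀ x y → GPAdj n k x y ⇔ (Step (vertex x) (vertex y) ⊎ Step (vertex y) (vertex x))
    gpAdj⇔step (inj₁ i) (inj₁ j) = toℕ+≡[mod]⇔ i j 1 ⊎-⇔ toℕ+≡[mod]⇔ j i 1
    gpAdj⇔step (inj₁ i) (inj₂ j) = mk⇔ (cong (_+ₙ 1ₙ)) (+-cancelʳ 1ₙ i j) ⊎-⇔ ⇔-id _
    gpAdj⇔step (inj₂ i) (inj₁ j) = ⇔-id _ ⊎-⇔ mk⇔ (cong (_+ₙ 1ₙ)) (+-cancelʳ 1ₙ j i)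
    gpAdj⇔step (inj₂ i) (inj₂ j) = begin
      (((toℕ i + k) ≡ toℕ j [mod n ]) ⊎ ((toℕ j + k) ≡ toℕ i [mod n ]))  ∼⟨ toℕ+≡[mod]⇔ i j k ⊎-⇔ toℕ+≡[mod]⇔ j i k ⟩
      ((i +ₙ [ k ] ≡ j) ⊎ (j +ₙ [ k ] ≡ i))                              ∼⟨ translation-by-±⇔ [k]≡±m i j ⟩
      ((i +ₙ m ≡ j) ⊎ (j +ₙ m ≡ i))                                      ∼⟨ layer₂-step⇔ i j ⊎-⇔ layer₂-step⇔ j i ⟩
      (Step (vertex (inj₂ i)) (vertex (inj₂ j)) ⊎ Step (vertex (inj₂ j)) (vertex (inj₂ i))) ∎
      where open EquationalReasoning

    gpAdj⇔underlyingAdj : ∀ x y → GPAdj n k x y ⇔ UnderlyingAdj _∙_ generators (vertex x) (vertex y)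
    gpAdj⇔underlyingAdj x y = ⇔-sym (underlyingAdj⇔step act-1ₙ≢0ₙ (vertex x) (vertex y)) ⇔-∘ gpAdj⇔step x y

theorem3p11 : (n k : ℕ) → 0 < k → 2 * k < n →
    ((k * k) ≡ k [mod n ]) ⊎ ((k * k + k) ≡ 0 [mod n ]) →
    Σ Set λ M → Σ (M → M → M) λ _∙_ → Σ M λ ε →
      IsMonoid _≡_ _∙_ ε × IsOrthogroup _∙_ ×
      Σ (M → Set) λ C →
        CayLoopless _∙_ C ×
        Σ (GPVertex n ↔ M) λ φ →
          ∀ x y → GPAdj n k x y ⇔ UnderlyingAdj _∙_ C (Inverse.to φ x) (Inverse.to φ y)
theorem3p11 zero _ _ () _
theorem3p11 n@(suc _) k 0<k 2k<n hyp =
  M , _∙_ , ε , isMonoid , isOrthogroup ,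
  generators , loopless act-1ₙ≢0ₙ , layers , gpAdj⇔underlyingAdj
  where
  open GeneralizedPetersen n
  k<n : k < n
  k<n = ℕ.≤-<-trans (ℕ.m≤m+n k (k + 0)) 2k<n
  open CayleyPresentation k hyp ([]≢0ₙ z<s (ℕ.≤-<-trans 0<k k<n)) ([]≢0ₙ 0<k k<n)
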